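{- Let $A$ be a finite alphabet, $W$ a finite state automaton over $A$ with $L=L(W)$, and for each $x\in A\cup\{\epsilon\}$ let $M_x$ be a two-tape asynchronous automaton over $A$ with $L_x=L(M_x)$. Then each of the following statements is decidable (there is an algorithm which, given $W$ and the $M_x$, correctly determines whether it holds): Axiom 1: $(\exists w)(w\in L)$; Axiom 2: for each $x\in A\cup\{\epsilon\}$, $(\forall w,v)((w,v)\in L_x\implies w\in L\wedge v\in L)$; Axiom 6: for each $x\in A$, $(\forall u)(u\in L\implies(\exists v)((u,v)\in L_x))$; Axiom 9: for each $x\in A$, $(\forall v)(v\in L\implies(\exists u)((u,v)\in L_x))$. (All variables range over $A^\ast$.)
   Context: A two-tape asynchronous automaton over $A$ is a partial deterministic finite state automaton (unique start state, no $\epsilon$-transitions, at most one transition per state and letter) over $A\sqcup\{\$\}$, $\$\notin A$, with its states partitioned into a left set $S_L$ and a right set $S_R$; it accepts $(u,v)\in A^\ast\times A^\ast$ iff there is a path from the start state to an accept state such that the concatenation of labels of the transitions with source in $S_L$ is $u\$$ and that of those with source in $S_R$ is $v\$$. -}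

module Defs where

open import Data.Nat using (ℕ)
open import Data.Fin using (Fin)
open import Data.Bool using (Bool; true)
open import Data.Maybe using (Maybe; just; nothing)
open import Data.List using (List; []; _∷_; _++_; [_]; map)
open import Data.Product using (Σ; ∃; _×_)
open import Relation.Binary.PropositionalEquality using (_≡_)

Word : ℕ → Set
Word k = List (Fin k)

-- Finite state automaton over A (general: nondeterministic, possibly
-- several start states and ε-transitions; a transition labelled
-- 'nothing' is an ε-transition).

record FSA (k : ℕ) : Set where
  field
    nStates : ℕ
    start   : Fin nStates → Bool
    accept  : Fin nStates → Bool
    trans   : Fin nStates → Maybe (Fin k) → Fin nStates → Bool

module _ {k : ℕ} (W : FSA k) where
  open FSA W

  data Run : Fin nStates → Word k → Fin nStates → Set where
    done : ∀ {q} → Run q [] q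
    step : ∀ {q a q' w q''} → trans q (just a) q' ≡ true →
           Run q' w q'' → Run q (a ∷ w) q''
    eps  : ∀ {q q' w q''} → trans q nothing q' ≡ true →
           Run q' w q'' → Run q w q''

  InL : Word k → Set
  InL w = Σ (Fin nStates) λ q → Σ (Fin nStates) λ q' →
            start q ≡ true × accept q' ≡ true × Run q w q'

-- Two-tape asynchronous automaton over A.
-- Letters of A ⊔ {$}: 'just a' is a ∈ A, 'nothing' is the symbol $.

Sym : ℕ → Set
Sym k = Maybe (Fin k)

data Side : Set where
  left right : Side

record TwoTape (k : ℕ) : Set where
  field
    nStates : ℕ
    side    : Fin nStates → Side
    start   : Fin nStates
    accept  : Fin nStates → Bool
    trans   : Fin nStates → Sym k → Maybe (Fin nStates)

module _ {k : ℕ} (M : TwoTape k) where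
  open TwoTape M

  data Path : Fin nStates → List (Sym k) → List (Sym k) → Fin nStates → Set where
    done   : ∀ {q} → Path q [] [] q
    stepL  : ∀ {q s q' l r q''} → side q ≡ left → trans q s ≡ just q' →
             Path q' l r q'' → Path q (s ∷ l) r q''
    stepR  : ∀ {q s q' l r q''} → side q ≡ right → trans q s ≡ just q' →
             Path q' l r q'' → Path q l (s ∷ r) q''

  enc : Word k → List (Sym k)
  enc u = map just u ++ [ nothing ]

  Accepts : Word k → Word k → Set
  Accepts u v = Σ (Fin nStates) λ q → accept q ≡ true × Path start (enc u) (enc v) q

-- The axioms.  The family M_x is indexed by x ∈ A ∪ {ε} = Maybe (Fin k),
-- with 'nothing' standing for ε.

module _ {k : ℕ} (W : FSA k) (M : Maybe (Fin k) → TwoTape k) where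

  Axiom1 : Set
  Axiom1 = Σ (Word k) λ w → InL W w

  Axiom2 : Maybe (Fin k) → Set
  Axiom2 x = ∀ (w v : Word k) → Accepts (M x) w v → InL W w × InL W v

  Axiom6 : Fin k → Set
  Axiom6 x = ∀ (u : Word k) → InL W u → Σ (Word k) λ v → Accepts (M (just x)) u v

  Axiom9 : Fin k → Set
  Axiom9 x = ∀ (v : Word k) → InL W v → Σ (Word k) λ u → Accepts (M (just x)) u v

module Submission where

-- Every language involved is recognised
-- by a deterministic automaton with a finite state set (a 'DFA' below).  Such
-- recognisers are closed under complement and intersection, and emptiness of
-- their language is decidable because it reduces to reachability in a finite
-- graph.  Consequently 'L ≠ ∅' and inclusions 'L₁ ⊆ L₂' (i.e. emptiness of
-- L₁ ∩ ¬L₂) are decidable.  It remains to find recognisers for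
--   * L(W): a nondeterministic automaton with ε-moves is determinised by the
--     subset construction (done once, for a general 'NFA');
--   * the two projections {u | ∃v. (u,v) ∈ L(M)} and {v | ∃u. (u,v) ∈ L(M)}:
--     the left projection is the language of the NFA that runs M, treating
--     the moves of right states as ε-moves and remembering only whether the
--     right tape's $ has been read; the right projection is the left
--     projection of M with the two sides exchanged.
-- Axiom 1 is non-emptiness of L(W); Axiom 2 is the pair of inclusions of the
-- projections of L(M_x) into L(W); Axioms 6 and 9 are inclusions of L(W) into
-- the projections of L(M_x).

open import Defs
open import Data.Bool using (Bool; true; false; T)
open import Data.Bool.Properties using () renaming (_≟_ to _≟ᴮ_)
open import Data.Fin using (Fin)
open import Data.Fin.Properties using () renaming (_≟_ to _≟ᶠ_)
open import Data.List using (List; []; _∷_; _++_; [_]; map; foldr; length; lookup; allFin; cartesianProduct)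
open import Data.List.Membership.Propositional using (_∈_)
open import Data.List.Membership.Propositional.Properties using (∈-allFin; ∈-cartesianProduct⁺; ∈-map⁺)
open import Data.List.Relation.Unary.Any using (here; there; any?; satisfied; index)
import Data.List.Relation.Unary.Any as Any
open import Data.List.Relation.Unary.Any.Properties using (lookup-index)
import Data.Maybe.Properties as Maybe
open import Data.Maybe using (Maybe; just; nothing)
open import Data.Nat using (ℕ; zero; suc)
open import Data.Product using (Σ; _×_; _,_; proj₁; proj₂)
import Data.Product.Properties as Product
open import Data.Sum using (_⊎_; inj₁; inj₂)
open import Function.Bundles using (_⇔_; mk⇔)
open import Data.Vec using (Vec; tabulate) renaming (lookup to lookupᵛ; [] to []ᵛ; _∷_ to _∷ᵛ_)
import Data.Vec.Properties as Vec
open import Relation.Binary.Construct.Closure.ReflexiveTransitive using (Star; ε; _◅_; _◅◅_)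
open import Relation.Binary.Definitions using (DecidableEquality)
open import Relation.Binary.PropositionalEquality using (_≡_; refl; sym; cong; subst) renaming (trans to ≡-trans)
open import Relation.Nullary using (Dec; yes; no; ¬_)
open import Relation.Nullary.Decidable using (_×-dec_; _⊎-dec_; map′; ¬?; T?; isYes; toWitness; fromWitness; decidable-stable) renaming (map to decMap)
open import Relation.Unary using (Decidable)

record Finite (A : Set) : Set where
  field
    elements   : List A
    enumerates : ∀ x → x ∈ elements
    decEq      : DecidableEquality A

open Finite

∃? : {A : Set} {P : A → Set} → Finite A → Decidable P → Dec (Σ A P)
∃? {P = P} F P? with any? P? (elements F)
... | yes found = yes (satisfied found)
... | no none   = no λ (x , px) → none (Any.map (λ { refl → px }) (enumerates F x))

finiteFin : (n : ℕ) → Finite (Fin n)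
finiteFin n = record { elements = allFin n ; enumerates = ∈-allFin ; decEq = _≟ᶠ_ }

finiteBool : Finite Bool
finiteBool = record { elements = true ∷ false ∷ [] ; enumerates = listed ; decEq = _≟ᴮ_ }
  where
  listed : ∀ b → b ∈ true ∷ false ∷ []
  listed true  = here refl
  listed false = there (here refl)

finiteMaybe : {A : Set} → Finite A → Finite (Maybe A)
finiteMaybe F = record
  { elements = nothing ∷ map just (elements F) ; enumerates = listed ; decEq = Maybe.≡-dec (decEq F) }
  where
  listed : ∀ x → x ∈ nothing ∷ map just (elements F)
  listed nothing  = here refl
  listed (just x) = there (∈-map⁺ just (enumerates F x))

finiteProduct : {A B : Set} → Finite A → Finite B → Finite (A × B)
finiteProduct FA FB = record
  { elements   = cartesianProduct (elements FA) (elements FB)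
  ; enumerates = λ (x , y) → ∈-cartesianProduct⁺ (enumerates FA x) (enumerates FB y)
  ; decEq      = Product.≡-dec (decEq FA) (decEq FB) }

finiteVec : {A : Set} → Finite A → (n : ℕ) → Finite (Vec A n)
finiteVec {A} F n = record { elements = vectors n ; enumerates = listed ; decEq = Vec.≡-dec (decEq F) }
  where
  vectors : (n : ℕ) → List (Vec A n)
  vectors zero    = []ᵛ ∷ []
  vectors (suc n) = map (λ (x , xs) → x ∷ᵛ xs) (cartesianProduct (elements F) (vectors n))
  listed : ∀ {n} (xs : Vec A n) → xs ∈ vectors n
  listed []ᵛ        = here refl
  listed (x ∷ᵛ xs) = ∈-map⁺ (λ (x , xs) → x ∷ᵛ xs) (∈-cartesianProduct⁺ (enumerates F x) (listed xs))

-- Subsets of a finite type, as bit vectors indexed by the enumeration.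
-- Unlike predicates, these form a finite type themselves, which is what
-- the subset construction needs.

module Subsets {S : Set} (F : Finite S) where

  Subset : Set
  Subset = Vec Bool (length (elements F))

  finiteSubset : Finite Subset
  finiteSubset = finiteVec finiteBool (length (elements F))

  position : S → Fin (length (elements F))
  position x = index (enumerates F x)

  _∋_ : Subset → S → Set
  X ∋ x = T (lookupᵛ X (position x))

  _∋?_ : ∀ X x → Dec (X ∋ x)
  X ∋? x = T? (lookupᵛ X (position x))

  ⟦_⟧ : {P : S → Set} → Decidable P → Subset
  ⟦ P? ⟧ = tabulate λ i → isYes (P? (lookup (elements F) i))

  ⟦⟧-bit : {P : S → Set} (P? : Decidable P) (x : S) → lookupᵛ ⟦ P? ⟧ (position x) ≡ isYes (P? x)
  ⟦⟧-bit P? x = ≡-trans (Vec.lookup∘tabulate _ (position x))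
                        (cong (λ y → isYes (P? y)) (sym (lookup-index (enumerates F x))))

  ⟦⟧-sound : {P : S → Set} (P? : Decidable P) {x : S} → ⟦ P? ⟧ ∋ x → P x
  ⟦⟧-sound P? {x} x∈ = toWitness {a? = P? x} (subst T (⟦⟧-bit P? x) x∈)

  ⟦⟧-complete : {P : S → Set} (P? : Decidable P) {x : S} → P x → ⟦ P? ⟧ ∋ x
  ⟦⟧-complete P? {x} px = subst T (sym (⟦⟧-bit P? x)) (fromWitness {a? = P? x} px)

-- Floyd–Warshall: 'Via ys a b' says that b is reachable from a by a path
-- whose intermediate vertices lie in ys; it is decidable by recursion on
-- ys, and for ys the full enumeration it is plain reachability.

module Reachability {S : Set} (F : Finite S) (E : S → S → Set) (E? : ∀ a b → Dec (E a b)) where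

  Via : List S → S → S → Set
  Via []       a b = a ≡ b ⊎ E a b
  Via (c ∷ ys) a b = Via ys a b ⊎ (Via ys a c × Via ys c b)

  via? : ∀ ys a b → Dec (Via ys a b)
  via? []       a b = decEq F a b ⊎-dec E? a b
  via? (c ∷ ys) a b = via? ys a b ⊎-dec (via? ys a c ×-dec via? ys c b)

  via-sound : ∀ ys {a b} → Via ys a b → Star E a b
  via-sound []       (inj₁ refl)     = ε
  via-sound []       (inj₂ e)        = e ◅ ε
  via-sound (c ∷ ys) (inj₁ p)        = via-sound ys p
  via-sound (c ∷ ys) (inj₂ (p , p')) = via-sound ys p ◅◅ via-sound ys p'

  data Through (ys : List S) : S → S → Set where
    last : ∀ {a b} → a ≡ b ⊎ E a b → Through ys a b
    _▸_  : ∀ {a v b} → E a v × v ∈ ys → Through ys v b → Through ys a b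

  -- A path through c ∷ ys either avoids c, or is cut into the part up to its
  -- first visit of c and the part after its last visit of c.
  split : ∀ {c ys a b} → Through (c ∷ ys) a b →
          Through ys a b ⊎ (Through ys a c × Through ys c b)
  split (last e) = inj₁ (last e)
  split ((e , here refl) ▸ p) with split p
  ... | inj₁ q       = inj₂ (last (inj₂ e) , q)
  ... | inj₂ (_ , q) = inj₂ (last (inj₂ e) , q)
  split ((e , there v∈) ▸ p) with split p
  ... | inj₁ q        = inj₁ ((e , v∈) ▸ q)
  ... | inj₂ (q , q') = inj₂ ((e , v∈) ▸ q , q')

  via-complete : ∀ ys {a b} → Through ys a b → Via ys a b
  via-complete []       (last e)       = e
  via-complete []       ((_ , ()) ▸ _)
  via-complete (c ∷ ys) p with split p
  ... | inj₁ q        = inj₁ (via-complete ys q)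
  ... | inj₂ (q , q') = inj₂ (via-complete ys q , via-complete ys q')

  star⇒through : ∀ {a b} → Star E a b → Through (elements F) a b
  star⇒through ε       = last (inj₁ refl)
  star⇒through (e ◅ s) = (e , enumerates F _) ▸ star⇒through s

  star? : ∀ a b → Dec (Star E a b)
  star? a b = map′ (via-sound (elements F)) (λ s → via-complete (elements F) (star⇒through s))
                   (via? (elements F) a b)

-- A DFA over A recognising P has a finite state set, reads a word from
-- right to left (so it recognises P in the usual sense after reversing
-- words, which is immaterial for decidability), and accepts exactly the
-- words satisfying P.

record DFA (A : Set) (P : List A → Set) : Set₁ where
  field
    State    : Set
    finite   : Finite State
    next     : A → State → State
    initial  : State
    Good     : State → Set
    good?    : Decidable Good
    sound    : ∀ w → Good (foldr next initial w) → P w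
    complete : ∀ w → P w → Good (foldr next initial w)

  run : List A → State
  run = foldr next initial

module _ {A : Set} where

  member? : {P : List A → Set} → DFA A P → Decidable P
  member? D w = map′ (sound w) (complete w) (good? (run w))
    where open DFA D

  dfaEquiv : {P Q : List A → Set} → (∀ w → P w → Q w) → (∀ w → Q w → P w) → DFA A P → DFA A Q
  dfaEquiv P⇒Q Q⇒P D = record
    { State = State ; finite = finite ; next = next ; initial = initial ; Good = Good ; good? = good?
    ; sound = λ w g → P⇒Q w (sound w g) ; complete = λ w q → complete w (Q⇒P w q) }
    where open DFA D

  dfaNot : {P : List A → Set} → DFA A P → DFA A (λ w → ¬ P w)
  dfaNot D = record
    { State = State ; finite = finite ; next = next ; initial = initial
    ; Good = λ X → ¬ Good X ; good? = λ X → ¬? (good? X)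
    ; sound = λ w bad p → bad (complete w p) ; complete = λ w ¬p g → ¬p (sound w g) }
    where open DFA D

  dfaAnd : {P Q : List A → Set} → DFA A P → DFA A Q → DFA A (λ w → P w × Q w)
  dfaAnd {P} {Q} D E = record
    { State = D.State × E.State ; finite = finiteProduct D.finite E.finite
    ; next = next ; initial = D.initial , E.initial
    ; Good = λ (x , y) → D.Good x × E.Good y ; good? = λ (x , y) → D.good? x ×-dec E.good? y
    ; sound = λ w g → let (gx , gy) = subst Good² (run-pair w) g in D.sound w gx , E.sound w gy
    ; complete = λ w (p , q) → subst Good² (sym (run-pair w)) (D.complete w p , E.complete w q) }
    where
    module D = DFA D
    module E = DFA E
    next : A → D.State × E.State → D.State × E.State
    next a (x , y) = D.next a x , E.next a y
    Good² : D.State × E.State → Set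
    Good² (x , y) = D.Good x × E.Good y
    run-pair : ∀ w → foldr next (D.initial , E.initial) w ≡ (D.run w , E.run w)
    run-pair []      = refl
    run-pair (a ∷ w) = cong (next a) (run-pair w)

  -- Emptiness is decidable for a finite alphabet: some word is accepted iff
  -- some good state reaches the initial state backwards along letter edges.
  nonEmpty? : {P : List A → Set} → Finite A → DFA A P → Dec (Σ (List A) P)
  nonEmpty? {P} FA D =
    map′ (λ (X , g , r) → let (w , X≡) = reaches⇒run r in w , sound w (subst Good X≡ g))
         (λ (w , p) → run w , complete w p , run-reaches w)
         (∃? finite λ X → good? X ×-dec star? X initial)
    where
    open DFA D
    Edge : State → State → Set
    Edge X Y = Σ A λ a → X ≡ next a Y
    open Reachability finite Edge (λ X Y → ∃? FA λ a → decEq finite X (next a Y))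
    run-reaches : ∀ w → Star Edge (run w) initial
    run-reaches []      = ε
    run-reaches (a ∷ w) = (a , refl) ◅ run-reaches w
    reaches⇒run : ∀ {X} → Star Edge X initial → Σ (List A) λ w → X ≡ run w
    reaches⇒run ε                = [] , refl
    reaches⇒run ((a , refl) ◅ r) = let (w , X≡) = reaches⇒run r in a ∷ w , cong (next a) X≡

  -- Inclusion of recognised languages is decidable: P ⊆ Q iff P ∩ ¬Q = ∅.
  included? : {P Q : List A → Set} → Finite A → DFA A P → DFA A Q → Dec (∀ w → P w → Q w)
  included? FA D E with nonEmpty? FA (dfaAnd D (dfaNot E))
  ... | yes (w , p , ¬q) = no λ P⊆Q → ¬q (P⊆Q w p)
  ... | no none          = yes λ w p → decidable-stable (member? E w) λ ¬q → none (w , p , ¬q)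

dfaTerminated : {A : Set} {P : List (Maybe A) → Set} →
                DFA (Maybe A) P → DFA A (λ u → P (map just u ++ [ nothing ]))
dfaTerminated {A} {P} D = record
  { State = State ; finite = finite ; next = λ a → next (just a) ; initial = next nothing initial
  ; Good = Good ; good? = good?
  ; sound = λ u g → sound (terminated u) (subst Good (run-terminated u) g)
  ; complete = λ u p → subst Good (sym (run-terminated u)) (complete (terminated u) p) }
  where
  open DFA D
  terminated : List A → List (Maybe A)
  terminated u = map just u ++ [ nothing ]
  run-terminated : ∀ u → foldr (λ a → next (just a)) (next nothing initial) u ≡ run (terminated u)
  run-terminated []      = refl
  run-terminated (a ∷ u) = cong (next (just a)) (run-terminated u)

record NFA (A : Set) : Set₁ where
  field
    State    : Set
    finite   : Finite State
    Initial  : State → Set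
    initial? : Decidable Initial
    Final    : State → Set
    final?   : Decidable Final
    Silent   : State → State → Set
    silent?  : ∀ p q → Dec (Silent p q)
    Move     : A → State → State → Set
    move?    : ∀ a p q → Dec (Move a p q)

module _ {A : Set} (N : NFA A) where
  open NFA N

  data AcceptsFrom : State → List A → Set where
    stop   : ∀ {q} → Final q → AcceptsFrom q []
    move   : ∀ {a q q' w} → Move a q q' → AcceptsFrom q' w → AcceptsFrom q (a ∷ w)
    silent : ∀ {q q' w} → Silent q q' → AcceptsFrom q' w → AcceptsFrom q w

  Language : List A → Set
  Language w = Σ State λ q → Initial q × AcceptsFrom q w

module Determinisation {A : Set} (N : NFA A) where
  open NFA N
  open Subsets finite
  open Reachability finite Silent silent?

  Closes : State → Set
  Closes q = Σ State λ q' → Star Silent q q' × Final q'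

  Enters : A → Subset → State → Set
  Enters a Y q = Σ State λ p → Σ State λ p' → Star Silent q p × Move a p p' × Y ∋ p'

  closes? : Decidable Closes
  closes? q = ∃? finite λ q' → star? q q' ×-dec final? q'

  enters? : ∀ a Y → Decidable (Enters a Y)
  enters? a Y q = ∃? finite λ p → ∃? finite λ p' → star? q p ×-dec move? a p p' ×-dec (Y ∋? p')

  -- The subset construction, read backwards: 'run w' is the set of states
  -- from which w is accepted.
  accepting : Subset
  accepting = ⟦ closes? ⟧

  next : A → Subset → Subset
  next a Y = ⟦ enters? a Y ⟧

  run : List A → Subset
  run = foldr next accepting

  silently : ∀ {q p w} → Star Silent q p → AcceptsFrom N p w → AcceptsFrom N q w
  silently ε       acc = acc
  silently (s ◅ r) acc = silent s (silently r acc)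

  accepts-[] : ∀ {q} → AcceptsFrom N q [] → Closes q
  accepts-[] (stop f)       = _ , ε , f
  accepts-[] (silent s acc) = let (q' , r , f) = accepts-[] acc in q' , s ◅ r , f

  accepts-∷ : ∀ {q a w} → AcceptsFrom N q (a ∷ w) →
              Σ State λ p → Σ State λ p' → Star Silent q p × Move a p p' × AcceptsFrom N p' w
  accepts-∷ (move m acc)   = _ , _ , ε , m , acc
  accepts-∷ (silent s acc) = let (p , p' , r , m , acc') = accepts-∷ acc in p , p' , s ◅ r , m , acc'

  run-sound : ∀ w {q} → run w ∋ q → AcceptsFrom N q w
  run-sound []      q∈ = let (q' , r , f) = ⟦⟧-sound closes? q∈ in silently r (stop f)
  run-sound (a ∷ w) q∈ =
    let (p , p' , r , m , p'∈) = ⟦⟧-sound (enters? a (run w)) q∈ in silently r (move m (run-sound w p'∈))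

  run-complete : ∀ w {q} → AcceptsFrom N q w → run w ∋ q
  run-complete []      acc = ⟦⟧-complete closes? (accepts-[] acc)
  run-complete (a ∷ w) acc =
    let (p , p' , r , m , acc') = accepts-∷ acc in ⟦⟧-complete (enters? a (run w)) (p , p' , r , m , run-complete w acc')

  determinise : DFA A (Language N)
  determinise = record
    { State = Subset ; finite = finiteSubset ; next = next ; initial = accepting
    ; Good = λ X → Σ State λ q → Initial q × X ∋ q
    ; good? = λ X → ∃? finite λ q → initial? q ×-dec (X ∋? q)
    ; sound = λ w (q , i , q∈) → q , i , run-sound w q∈
    ; complete = λ w (q , i , acc) → q , i , run-complete w acc }

module _ {k : ℕ} (W : FSA k) where
  open FSA W

  fsaNFA : NFA (Fin k)
  fsaNFA = record
    { State = Fin nStates ; finite = finiteFin nStates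
    ; Initial = λ q → start q ≡ true ; initial? = λ q → start q ≟ᴮ true
    ; Final = λ q → accept q ≡ true ; final? = λ q → accept q ≟ᴮ true
    ; Silent = λ p q → trans p nothing q ≡ true ; silent? = λ p q → trans p nothing q ≟ᴮ true
    ; Move = λ a p q → trans p (just a) q ≡ true ; move? = λ a p q → trans p (just a) q ≟ᴮ true }

  run⇒accepts : ∀ {q w q'} → Run W q w q' → accept q' ≡ true → AcceptsFrom fsaNFA q w
  run⇒accepts done       f = stop f
  run⇒accepts (step t r) f = move t (run⇒accepts r f)
  run⇒accepts (eps e r)  f = silent e (run⇒accepts r f)

  accepts⇒run : ∀ {q w} → AcceptsFrom fsaNFA q w → Σ (Fin nStates) λ q' → accept q' ≡ true × Run W q w q'
  accepts⇒run (stop f)       = _ , f , done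
  accepts⇒run (move t acc)   = let (q' , f , r) = accepts⇒run acc in q' , f , step t r
  accepts⇒run (silent e acc) = let (q' , f , r) = accepts⇒run acc in q' , f , eps e r

  fsaDFA : DFA (Fin k) (InL W)
  fsaDFA = dfaEquiv (λ w (q , i , acc) → let (q' , f , r) = accepts⇒run acc in q , q' , i , f , r)
                    (λ w (q , q' , i , f , r) → q , i , run⇒accepts r f)
                    (Determinisation.determinise fsaNFA)

-- The NFA runs M on the left tape; moves of right states
-- become silent, and the unread part of the right tape is forgotten except
-- for whether its $ has been read.

-- HiddenStep d s d': reading symbol s on the hidden tape moves its phase
-- from d to d' (false: before the $, true: after it).
data HiddenStep {k : ℕ} : Bool → Sym k → Bool → Set where
  letter : ∀ {a} → HiddenStep false (just a) false
  dollar : HiddenStep false nothing true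

hiddenStep? : ∀ {k} d (s : Sym k) d' → Dec (HiddenStep d s d')
hiddenStep? false (just a) false = yes letter
hiddenStep? false nothing  true  = yes dollar
hiddenStep? false (just a) true  = no λ ()
hiddenStep? false nothing  false = no λ ()
hiddenStep? true  s        d'    = no λ ()

data Hidden {k : ℕ} : Bool → List (Sym k) → Set where
  end : Hidden true []
  _∷_ : ∀ {d s d' r} → HiddenStep d s d' → Hidden d' r → Hidden d (s ∷ r)

hidden-terminated : ∀ {k} (v : Word k) → Hidden false (map just v ++ [ nothing ])
hidden-terminated []      = dollar ∷ end
hidden-terminated (a ∷ v) = letter ∷ hidden-terminated v

hidden-word : ∀ {k} {r : List (Sym k)} → Hidden false r → Σ (Word k) λ v → r ≡ map just v ++ [ nothing ]
hidden-word (dollar ∷ end) = [] , refl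
hidden-word (letter {a} ∷ h) = let (v , r≡) = hidden-word h in a ∷ v , cong (just a ∷_) r≡

_≟ˢ_ : DecidableEquality Side
left  ≟ˢ left  = yes refl
left  ≟ˢ right = no λ ()
right ≟ˢ left  = no λ ()
right ≟ˢ right = yes refl

module LeftProjection {k : ℕ} (M : TwoTape k) where
  open TwoTape M

  -- A state of M together with the phase of the hidden right tape.
  Configuration : Set
  Configuration = Fin nStates × Bool

  Silent : Configuration → Configuration → Set
  Silent (m , d) (m' , d') = side m ≡ right × Σ (Sym k) λ s → trans m s ≡ just m' × HiddenStep d s d'

  Move : Sym k → Configuration → Configuration → Set
  Move s (m , d) (m' , d') = side m ≡ left × trans m s ≡ just m' × d' ≡ d

  leftNFA : NFA (Sym k)
  leftNFA = record
    { State = Configuration ; finite = finiteProduct (finiteFin nStates) finiteBool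
    ; Initial = λ c → c ≡ (start , false)
    ; initial? = λ c → decEq (finiteProduct (finiteFin nStates) finiteBool) c (start , false)
    ; Final = λ (m , d) → accept m ≡ true × d ≡ true
    ; final? = λ (m , d) → (accept m ≟ᴮ true) ×-dec (d ≟ᴮ true)
    ; Silent = Silent
    ; silent? = λ (m , d) (m' , d') → (side m ≟ˢ right) ×-dec
        ∃? (finiteMaybe (finiteFin k)) λ s → Maybe.≡-dec _≟ᶠ_ (trans m s) (just m') ×-dec hiddenStep? d s d'
    ; Move = Move
    ; move? = λ s (m , d) (m' , d') →
        (side m ≟ˢ left) ×-dec Maybe.≡-dec _≟ᶠ_ (trans m s) (just m') ×-dec (d' ≟ᴮ d) }

  path⇒accepts : ∀ {m l r qf d} → Path M m l r qf → accept qf ≡ true → Hidden d r →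
                 AcceptsFrom leftNFA (m , d) l
  path⇒accepts done             f end      = stop (f , refl)
  path⇒accepts (stepL sd t p)   f h        = move (sd , t , refl) (path⇒accepts p f h)
  path⇒accepts (stepR sd t p)   f (hs ∷ h) = silent (sd , _ , t , hs) (path⇒accepts p f h)

  accepts⇒path : ∀ {m d l} → AcceptsFrom leftNFA (m , d) l →
                 Σ (List (Sym k)) λ r → Hidden d r × Σ (Fin nStates) λ qf → accept qf ≡ true × Path M m l r qf
  accepts⇒path (stop (f , refl)) = [] , end , _ , f , done
  accepts⇒path (move (sd , t , refl) acc) =
    let (r , h , qf , f , p) = accepts⇒path acc in r , h , qf , f , stepL sd t p
  accepts⇒path (silent (sd , s , t , hs) acc) =
    let (r , h , qf , f , p) = accepts⇒path acc in s ∷ r , hs ∷ h , qf , f , stepR sd t p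

  leftDFA : DFA (Fin k) (λ u → Σ (Word k) λ v → Accepts M u v)
  leftDFA = dfaEquiv
    (λ { u (_ , refl , acc) → let (r , h , qf , f , p) = accepts⇒path acc
                                  (v , r≡) = hidden-word h
                              in v , qf , f , subst (λ r → Path M start _ r qf) r≡ p })
    (λ u (v , qf , f , p) → _ , refl , path⇒accepts p f (hidden-terminated v))
    (dfaTerminated (Determinisation.determinise leftNFA))

open LeftProjection using (leftDFA)

-- The right projection { v | ∃ u. (u , v) ∈ L(M) } is the left projection
-- of M with the roles of left and right states exchanged.

flip : Side → Side
flip left  = right
flip right = left

flip-involutive : ∀ s → flip (flip s) ≡ s
flip-involutive left  = refl
flip-involutive right = refl

flip-injective : ∀ {s s'} → flip s ≡ flip s' → s ≡ s'
flip-injective {s} {s'} eq =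
  ≡-trans (sym (flip-involutive s)) (≡-trans (cong flip eq) (flip-involutive s'))

swap : ∀ {k} → TwoTape k → TwoTape k
swap M = record { nStates = nStates ; side = λ q → flip (side q) ; start = start ; accept = accept ; trans = trans }
  where open TwoTape M

module _ {k : ℕ} (M : TwoTape k) where

  swap-path : ∀ {q l r q'} → Path M q r l q' → Path (swap M) q l r q'
  swap-path done           = done
  swap-path (stepL sd t p) = stepR (cong flip sd) t (swap-path p)
  swap-path (stepR sd t p) = stepL (cong flip sd) t (swap-path p)

  unswap-path : ∀ {q l r q'} → Path (swap M) q l r q' → Path M q r l q'
  unswap-path done           = done
  unswap-path (stepL sd t p) = stepR (flip-injective sd) t (unswap-path p)
  unswap-path (stepR sd t p) = stepL (flip-injective sd) t (unswap-path p)

  rightDFA : DFA (Fin k) (λ v → Σ (Word k) λ u → Accepts M u v)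
  rightDFA = dfaEquiv (λ v (u , qf , f , p) → u , qf , f , unswap-path p)
                      (λ v (u , qf , f , p) → u , qf , f , swap-path p)
                      (leftDFA (swap M))

axiom2⇔projections : ∀ {k} (W : FSA k) (M : Maybe (Fin k) → TwoTape k) x →
  ((∀ u → (Σ (Word k) λ v → Accepts (M x) u v) → InL W u) ×
   (∀ v → (Σ (Word k) λ u → Accepts (M x) u v) → InL W v)) ⇔ Axiom2 W M x
axiom2⇔projections W M x = mk⇔
  (λ (leftIn , rightIn) u v acc → leftIn u (v , acc) , rightIn v (u , acc))
  (λ ax → (λ u (v , acc) → proj₁ (ax u v acc)) , (λ v (u , acc) → proj₂ (ax u v acc)))

mainTheorem12 : (k : ℕ) (W : FSA k) (M : Maybe (Fin k) → TwoTape k) →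
    Dec (Axiom1 W M)
    × ((x : Maybe (Fin k)) → Dec (Axiom2 W M x))
    × ((x : Fin k) → Dec (Axiom6 W M x))
    × ((x : Fin k) → Dec (Axiom9 W M x))
mainTheorem12 k W M =
    nonEmpty? alphabet (fsaDFA W)
  , (λ x → decMap (axiom2⇔projections W M x)
             (included? alphabet (leftDFA (M x)) (fsaDFA W) ×-dec included? alphabet (rightDFA (M x)) (fsaDFA W)))
  , (λ x → included? alphabet (fsaDFA W) (leftDFA (M (just x))))
  , (λ x → included? alphabet (fsaDFA W) (rightDFA (M (just x))))
  where
  alphabet : Finite (Fin k)
  alphabet = finiteFin k
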